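{- A super-domain $\mathbf D\subseteq\mathbf T$ is a Condorcet super-domain if and only if for any three tilings $T_1,T_2,T_3\in\mathbf D$, the pseudo-tiling $sm(T_1,T_2,T_3)=(T_1\cap T_2)\cup(T_2\cap T_3)\cup(T_3\cap T_1)$ is a tiling.
   Context: Fix an integer $n\ge 2$, $[n]=\{1,\dots,n\}$, and let $\Lambda$ be the set of triples $ijk$ with $i<j<k$ in $[n]$. For a quadruple $i<j<k<l$, its stick is the ordered sequence $(ijk,ijl,ikl,jkl)$. A subset of $\Lambda$ is a pseudo-tiling; it is a tiling if for every quadruple $i<j<k<l$ its intersection with the stick, written as a 0/1 string along the stick order, is one of $0000,1000,1100,1110,1111,0111,0011,0001$ (equivalently, these are the inversion sets of rhombus tilings of the zonogon $Z(n;2)$, by Ziegler's theorem). $\mathbf T$ denotes the set of tilings; a super-domain is a subset of $\mathbf T$. Majority rule: for a finite set $V$ of odd cardinality and a family $(T_v)_{v\in V}$ of tilings (repetitions allowed), $sm((T_v)_{v\in V})=\{ijk\in\Lambda: |\{v: ijk\in T_v\}|>|V|/2\}$. A super-domain $\mathbf D$ is a Condorcet super-domain if for every finite odd-cardinality $V$ and every family $(T_v)_{v\in V}$ with all $T_v\in\mathbf D$, $sm((T_v)_{v\in V})$ is a tiling. -}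

module Defs where

open import Data.Nat using (ℕ; zero; suc; _+_; _*_; _<ᵇ_)
open import Data.Fin using (Fin; zero; suc; _<_)
open import Data.Bool using (Bool; true; false; _∧_; _∨_; if_then_else_)
open import Data.Product using (∃)
open import Relation.Binary.PropositionalEquality using (_≡_)

-- A pseudo-tiling: a subset of Λ, given by its (decidable) membership
-- function on triples (i , j , k).  Only values on triples with
-- i < j < k are ever inspected; other values are irrelevant.
PseudoTiling : ℕ → Set
PseudoTiling n = Fin n → Fin n → Fin n → Bool

data AllowedStick : Bool → Bool → Bool → Bool → Set where
  s0000 : AllowedStick false false false false
  s1000 : AllowedStick true  false false false
  s1100 : AllowedStick true  true  false false
  s1110 : AllowedStick true  true  true  false
  s1111 : AllowedStick true  true  true  true
  s0111 : AllowedStick false true  true  true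
  s0011 : AllowedStick false false true  true
  s0001 : AllowedStick false false false true

IsTiling : {n : ℕ} → PseudoTiling n → Set
IsTiling {n} T = (i j k l : Fin n) → i < j → j < k → k < l →
  AllowedStick (T i j k) (T i j l) (T i k l) (T j k l)

-- A super-domain: a subset of the set of tilings, given as a predicate on
-- pseudo-tilings together with the requirement that its members are tilings.
SuperDomain : ℕ → Set₁
SuperDomain n = PseudoTiling n → Set

countTrue : (m : ℕ) → (Fin m → Bool) → ℕ
countTrue zero    f = 0
countTrue (suc m) f = (if f zero then 1 else 0) + countTrue m (λ v → f (suc v))

Odd : ℕ → Set
Odd m = ∃ λ q → m ≡ suc (2 * q)

-- Majority rule for a family (T_v)_{v ∈ Fin m}:
-- ijk ∈ sm iff |{v : ijk ∈ T_v}| > m / 2, i.e. m < 2 * count.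
sm : {n : ℕ} (m : ℕ) → (Fin m → PseudoTiling n) → PseudoTiling n
sm m Ts i j k = m <ᵇ 2 * countTrue m (λ v → Ts v i j k)

sm₃ : {n : ℕ} → PseudoTiling n → PseudoTiling n → PseudoTiling n → PseudoTiling n
sm₃ T₁ T₂ T₃ i j k =
  (T₁ i j k ∧ T₂ i j k) ∨ (T₂ i j k ∧ T₃ i j k) ∨ (T₃ i j k ∧ T₁ i j k)

-- Condorcet super-domain: majority of any odd finite family from D is a tiling.
-- (A finite index set V of odd cardinality m is represented by Fin m;
-- repetitions are allowed since Ts need not be injective.)
IsCondorcet : {n : ℕ} → SuperDomain n → Set
IsCondorcet {n} D = (m : ℕ) → Odd m → (Ts : Fin m → PseudoTiling n) →
  ((v : Fin m) → D (Ts v)) → IsTiling (sm m Ts)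

-- sm₃ is the majority of the odd family (T₁, T₂, T₃), which gives one
-- direction.  For the other: a stick is admissible exactly when none of its
-- sub-patterns at positions (1,2,3), (1,2,4), (2,3,4) is a zigzag x, ¬x, x.
-- Given such a zigzag in the majority of an odd family, the voters agreeing
-- with the majority on each of the three triples form three strict
-- majorities, which pairwise intersect; one voter from each pairwise
-- intersection gives three tilings whose majority reproduces the zigzag.
module Submission where

open import Defs
open import Data.Nat using (ℕ; _≤_)
open import Function.Bundles using (_⇔_)

open import Data.Bool using (Bool; true; false; not; _∧_; _∨_; T)
open import Data.Empty using (⊥-elim)
open import Data.Fin using (Fin; zero; suc)
open import Data.Fin.Properties using (any?)
open import Data.Nat using (zero; suc; _+_; _*_; _<_; _<ᵇ_; z≤n; s≤s)
open import Data.Nat.Properties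
open import Data.Product using (∃; ∃-syntax; _×_; _,_)
open import Data.Sum using (_⊎_; inj₁; inj₂)
open import Data.Vec.Functional using ([]; _∷_)
open import Function.Bundles using (mk⇔)
open import Relation.Binary.PropositionalEquality
open import Relation.Nullary using (yes; no; ¬_)
open import Relation.Nullary.Decidable using (T?; _×-dec_)

majority : (m : ℕ) → (Fin m → Bool) → Bool
majority m f = m <ᵇ 2 * countTrue m f

maj₃ : Bool → Bool → Bool → Bool
maj₃ a b c = (a ∧ b) ∨ (b ∧ c) ∨ (c ∧ a)

agrees : Bool → Bool → Bool
agrees true  b = b
agrees false b = not b

agrees-sound : ∀ x b → T (agrees x b) → b ≡ x
agrees-sound true  true  _ = refl
agrees-sound false false _ = refl

countTrue-complement : ∀ m (f : Fin m → Bool) →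
  countTrue m (λ v → not (f v)) + countTrue m f ≡ m
countTrue-complement zero    f = refl
countTrue-complement (suc m) f with f zero
... | true  = trans (+-suc _ _) (cong suc (countTrue-complement m (λ v → f (suc v))))
... | false = cong suc (countTrue-complement m (λ v → f (suc v)))

countTrue-disjoint : ∀ m (f g : Fin m → Bool) → (∀ v → ¬ (T (f v) × T (g v))) →
  countTrue m f + countTrue m g ≤ m
countTrue-disjoint zero    f g _ = z≤n
countTrue-disjoint (suc m) f g disj with f zero | g zero | disj zero
... | true  | true  | both = ⊥-elim (both (_ , _))
... | true  | false | _    = s≤s (countTrue-disjoint m _ _ (λ v → disj (suc v)))
... | false | true  | _    =
  subst (_≤ suc m) (sym (+-suc _ _)) (s≤s (countTrue-disjoint m _ _ (λ v → disj (suc v))))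
... | false | false | _    = m≤n⇒m≤1+n (countTrue-disjoint m _ _ (λ v → disj (suc v)))

majorities-meet : ∀ m (f g : Fin m → Bool) →
  m < 2 * countTrue m f → m < 2 * countTrue m g → ∃ λ v → T (f v) × T (g v)
majorities-meet m f g mf mg with any? (λ v → T? (f v) ×-dec T? (g v))
... | yes meet = meet
... | no disjoint = ⊥-elim (<-irrefl refl (begin-strict
  2 * m                                ≡⟨ cong (m +_) (+-identityʳ m) ⟩
  m + m                                <⟨ +-mono-< mf mg ⟩
  2 * countTrue m f + 2 * countTrue m g ≡⟨ *-distribˡ-+ 2 (countTrue m f) (countTrue m g) ⟨
  2 * (countTrue m f + countTrue m g)   ≤⟨ *-monoʳ-≤ 2 (countTrue-disjoint m f g (λ v fg → disjoint (v , fg))) ⟩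
  2 * m                                ∎))
  where open ≤-Reasoning

-- Oddness excludes a tie, so when the majority is false the voters for false
-- form a strict majority.
majority-is-majority : ∀ m → Odd m → (f : Fin m → Bool) →
  m < 2 * countTrue m (λ v → agrees (majority m f) (f v))
majority-is-majority m _ f with majority m f in eq
... | true = <ᵇ⇒< m _ (subst T (sym eq) _)
majority-is-majority m (q , refl) f | false = +-cancelʳ-< (2 * c) m (2 * c̄) (begin-strict
  m + 2 * c   <⟨ +-monoʳ-< m 2c<m ⟩
  m + m       ≡⟨ cong (m +_) (sym (+-identityʳ m)) ⟩
  2 * m       ≡⟨ cong (2 *_) (countTrue-complement m f) ⟨
  2 * (c̄ + c) ≡⟨ *-distribˡ-+ 2 c̄ c ⟩
  2 * c̄ + 2 * c ∎)
  where
  open ≤-Reasoning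
  c  = countTrue m f
  c̄ = countTrue m (λ v → not (f v))
  2c<m : 2 * c < m
  2c<m = ≤∧≢⇒< (≮⇒≥ (λ m<2c → subst T eq (<⇒<ᵇ m<2c))) (even≢odd c q)

maj₃-outer : ∀ a b {c} → a ≡ c → maj₃ a b c ≡ a
maj₃-outer true  true  refl = refl
maj₃-outer true  false refl = refl
maj₃-outer false true  refl = refl
maj₃-outer false false refl = refl

maj₃-left : ∀ a {b} c → a ≡ b → maj₃ a b c ≡ a
maj₃-left true  true  refl = refl
maj₃-left true  false refl = refl
maj₃-left false true  refl = refl
maj₃-left false false refl = refl

maj₃-right : ∀ a b {c} → b ≡ c → maj₃ a b c ≡ b
maj₃-right true  true  refl = refl
maj₃-right true  false refl = refl
maj₃-right false true  refl = refl
maj₃-right false false refl = refl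

majority-voters-meet : ∀ m → Odd m → (f g : Fin m → Bool) →
  ∃ λ v → f v ≡ majority m f × g v ≡ majority m g
majority-voters-meet m odd f g
  with majorities-meet m _ _ (majority-is-majority m odd f) (majority-is-majority m odd g)
... | v , fv , gv = v , agrees-sound (majority m f) (f v) fv , agrees-sound (majority m g) (g v) gv

majority-by-three-voters : ∀ m → Odd m → (f g h : Fin m → Bool) →
  ∃[ u ] ∃[ w ] ∃[ y ]
    maj₃ (f u) (f w) (f y) ≡ majority m f ×
    maj₃ (g u) (g w) (g y) ≡ majority m g ×
    maj₃ (h u) (h w) (h y) ≡ majority m h
majority-by-three-voters m odd f g h
  with majority-voters-meet m odd f g | majority-voters-meet m odd g h
     | majority-voters-meet m odd h f
... | u , fu , gu | w , gw , hw | y , hy , fy =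
  u , w , y ,
  trans (maj₃-outer (f u) (f w) (trans fu (sym fy))) fu ,
  trans (maj₃-left (g u) (g y) (trans gu (sym gw))) gu ,
  trans (maj₃-right (h u) (h w) (trans hw (sym hy))) hw

data Zigzag : Bool → Bool → Bool → Set where
  zigzag : ∀ x → Zigzag x (not x) x

zigzag-resp : ∀ {a b c a′ b′ c′} → a′ ≡ a → b′ ≡ b → c′ ≡ c → Zigzag a b c → Zigzag a′ b′ c′
zigzag-resp refl refl refl z = z

data BrokenStick : Bool → Bool → Bool → Bool → Set where
  broken₁₂₃ : ∀ {a b c d} → Zigzag a b c → BrokenStick a b c d
  broken₁₂₄ : ∀ {a b c d} → Zigzag a b d → BrokenStick a b c d
  broken₂₃₄ : ∀ {a b c d} → Zigzag b c d → BrokenStick a b c d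

allowed⊎broken : ∀ a b c d → AllowedStick a b c d ⊎ BrokenStick a b c d
allowed⊎broken false false false false = inj₁ s0000
allowed⊎broken true  false false false = inj₁ s1000
allowed⊎broken true  true  false false = inj₁ s1100
allowed⊎broken true  true  true  false = inj₁ s1110
allowed⊎broken true  true  true  true  = inj₁ s1111
allowed⊎broken false true  true  true  = inj₁ s0111
allowed⊎broken false false true  true  = inj₁ s0011
allowed⊎broken false false false true  = inj₁ s0001
allowed⊎broken false true  false _     = inj₂ (broken₁₂₃ (zigzag false))
allowed⊎broken true  false true  _     = inj₂ (broken₁₂₃ (zigzag true))
allowed⊎broken false true  true  false = inj₂ (broken₁₂₄ (zigzag false))
allowed⊎broken true  false false true  = inj₂ (broken₁₂₄ (zigzag true))
allowed⊎broken _     false true  false = inj₂ (broken₂₃₄ (zigzag false))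
allowed⊎broken _     true  false true  = inj₂ (broken₂₃₄ (zigzag true))

broken⇒¬allowed : ∀ {a b c d} → BrokenStick a b c d → ¬ AllowedStick a b c d
broken⇒¬allowed (broken₁₂₃ (zigzag true))  ()
broken⇒¬allowed (broken₁₂₃ (zigzag false)) ()
broken⇒¬allowed (broken₁₂₄ (zigzag true))  ()
broken⇒¬allowed (broken₁₂₄ (zigzag false)) ()
broken⇒¬allowed (broken₂₃₄ (zigzag true))  ()
broken⇒¬allowed (broken₂₃₄ (zigzag false)) ()

BrokenAt : ∀ {n} → PseudoTiling n → (i j k l : Fin n) → Set
BrokenAt S i j k l = BrokenStick (S i j k) (S i j l) (S i k l) (S j k l)

broken-by-three-voters : ∀ {n} m → Odd m → (Ts : Fin m → PseudoTiling n) → ∀ i j k l →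
  BrokenAt (sm m Ts) i j k l →
  ∃[ u ] ∃[ w ] ∃[ y ] BrokenAt (sm₃ (Ts u) (Ts w) (Ts y)) i j k l
broken-by-three-voters m odd Ts i j k l (broken₁₂₃ z)
  with majority-by-three-voters m odd (votes i j k) (votes i j l) (votes i k l)
  where votes = λ a b c v → Ts v a b c
... | u , w , y , e₁ , e₂ , e₃ = u , w , y , broken₁₂₃ (zigzag-resp e₁ e₂ e₃ z)
broken-by-three-voters m odd Ts i j k l (broken₁₂₄ z)
  with majority-by-three-voters m odd (votes i j k) (votes i j l) (votes j k l)
  where votes = λ a b c v → Ts v a b c
... | u , w , y , e₁ , e₂ , e₃ = u , w , y , broken₁₂₄ (zigzag-resp e₁ e₂ e₃ z)
broken-by-three-voters m odd Ts i j k l (broken₂₃₄ z)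
  with majority-by-three-voters m odd (votes i j l) (votes i k l) (votes j k l)
  where votes = λ a b c v → Ts v a b c
... | u , w , y , e₁ , e₂ , e₃ = u , w , y , broken₂₃₄ (zigzag-resp e₁ e₂ e₃ z)

IsTiling-resp : ∀ {n} {S S′ : PseudoTiling n} → (∀ i j k → S i j k ≡ S′ i j k) →
  IsTiling S → IsTiling S′
IsTiling-resp {S = S} {S′} S≗S′ tiling i j k l i<j j<k k<l =
  subst₂ (λ a b → AllowedStick a b (S′ i k l) (S′ j k l)) (S≗S′ i j k) (S≗S′ i j l)
    (subst₂ (AllowedStick (S i j k) (S i j l)) (S≗S′ i k l) (S≗S′ j k l)
      (tiling i j k l i<j j<k k<l))

majority-of-three : ∀ a b c → majority 3 (a ∷ b ∷ c ∷ []) ≡ maj₃ a b c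
majority-of-three true  true  true  = refl
majority-of-three true  true  false = refl
majority-of-three true  false true  = refl
majority-of-three true  false false = refl
majority-of-three false true  true  = refl
majority-of-three false true  false = refl
majority-of-three false false true  = refl
majority-of-three false false false = refl

Tiling₃ : ∀ {n} → SuperDomain n → Set
Tiling₃ {n} D = (T₁ T₂ T₃ : PseudoTiling n) → D T₁ → D T₂ → D T₃ → IsTiling (sm₃ T₁ T₂ T₃)

condorcet⇒tiling₃ : ∀ {n} (D : SuperDomain n) → IsCondorcet D → Tiling₃ D
condorcet⇒tiling₃ D condorcet T₁ T₂ T₃ d₁ d₂ d₃ =
  IsTiling-resp (λ i j k → majority-of-three (T₁ i j k) (T₂ i j k) (T₃ i j k))
    (condorcet 3 (1 , refl) (T₁ ∷ T₂ ∷ T₃ ∷ []) inD)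
  where
  inD : ∀ v → D ((T₁ ∷ T₂ ∷ T₃ ∷ []) v)
  inD zero             = d₁
  inD (suc zero)       = d₂
  inD (suc (suc zero)) = d₃

tiling₃⇒condorcet : ∀ {n} (D : SuperDomain n) → Tiling₃ D → IsCondorcet D
tiling₃⇒condorcet D tiling₃ m odd Ts inD i j k l i<j j<k k<l
  with allowed⊎broken (sm m Ts i j k) (sm m Ts i j l) (sm m Ts i k l) (sm m Ts j k l)
... | inj₁ allowed = allowed
... | inj₂ broken with broken-by-three-voters m odd Ts i j k l broken
...   | u , w , y , broken′ = ⊥-elim (broken⇒¬allowed broken′
          (tiling₃ (Ts u) (Ts w) (Ts y) (inD u) (inD w) (inD y) i j k l i<j j<k k<l))

theorem1 : (n : ℕ) → 2 ≤ n → (D : SuperDomain n) →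
    ((T : PseudoTiling n) → D T → IsTiling T) →
    (IsCondorcet D ⇔
      ((T₁ T₂ T₃ : PseudoTiling n) → D T₁ → D T₂ → D T₃ → IsTiling (sm₃ T₁ T₂ T₃)))
theorem1 n _ D _ = mk⇔ (condorcet⇒tiling₃ D) (tiling₃⇒condorcet D)
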